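{- Let $P=(p_{ij})_{i,j\ge0}$ be the matrix over $\mathbb R[x]$ with $p_{n,n+1}=1$, $p_{n,n}=2n+1+x$, $p_{n,n-1}=n^2+2nx$, $p_{n,n-2}=n(n-1)x$, and all other entries $0$. For $\boldsymbol\alpha=(\alpha_i)_{i\ge2}$ let $P^{(2;1)}(\boldsymbol\alpha)$ be the matrix with (using $\alpha_1=0$) $P_{n,n+1}=1$, $P_{n,n}=\alpha_{3n+1}+\alpha_{3n+2}+\alpha_{3n+3}$, $P_{n,n-1}=\alpha_{3n-1}\alpha_{3n+1}+\alpha_{3n}\alpha_{3n+1}+\alpha_{3n}\alpha_{3n+2}$, $P_{n,n-2}=\alpha_{3n-3}\alpha_{3n-1}\alpha_{3n+1}$, and all other entries $0$. Then a sequence $\boldsymbol\alpha$ of polynomials in $x$ with nonnegative real coefficients satisfies $P=P^{(2;1)}(\boldsymbol\alpha)$ if and only if $\alpha_{3n-1}=x$, $\alpha_{3n}=n$ and $\alpha_{3n+1}=n$ for all $n\ge1$.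
   Context: $P$ is the univariate Laguerre production matrix at Laguerre parameter $\alpha=0$; $P^{(2;1)}$ is the production matrix of the generalized $2$-Stieltjes–Rogers polynomials of type $1$, with entries as given in the claim. -}

module Defs where

open import Level using (0ℓ)
open import Data.Nat as ℕ using (ℕ; zero; suc; _∸_)
open import Data.Product using (Σ; _×_; _,_)
open import Relation.Nullary using (¬_)
open import Relation.Binary.PropositionalEquality using (_≡_)
open import Relation.Binary.Structures using (IsTotalOrder)
open import Algebra.Structures using (IsCommutativeRing)

-- An ordered field (with propositional equality on the carrier).
-- The real numbers ℝ are an instance; the statement is proved for all of them.
record OrderedField : Set₁ where
  infixl 6 _+_
  infixl 7 _*_
  infix 4 _≤_
  field
    Carrier : Set
    _+_ _*_ : Carrier → Carrier → Carrier
    -_      : Carrier → Carrier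
    0# 1#   : Carrier
    _≤_     : Carrier → Carrier → Set
    isCommutativeRing : IsCommutativeRing _≡_ _+_ _*_ -_ 0# 1#
    isTotalOrder      : IsTotalOrder _≡_ _≤_
    +-mono-≤   : ∀ {a b} c → a ≤ b → a + c ≤ b + c
    *-nonneg   : ∀ {a b} → 0# ≤ a → 0# ≤ b → 0# ≤ a * b
    0≢1        : ¬ (0# ≡ 1#)
    *-inverse  : ∀ a → ¬ (a ≡ 0#) → Σ Carrier (λ b → a * b ≡ 1#)

module _ (F : OrderedField) where
  open OrderedField F

  -- Coefficient sequences (formal power series in x); polynomials are those of finite support.
  Series : Set
  Series = ℕ → Carrier

  IsPoly : Series → Set
  IsPoly p = Σ ℕ (λ d → ∀ k → d ℕ.< k → p k ≡ 0#)

  NonnegCoeffs : Series → Set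
  NonnegCoeffs p = ∀ k → 0# ≤ p k

  _≈ₛ_ : Series → Series → Set
  p ≈ₛ q = ∀ k → p k ≡ q k

  fromℕ : ℕ → Carrier
  fromℕ zero    = 0#
  fromℕ (suc n) = 1# + fromℕ n

  constS : Carrier → Series
  constS c zero    = c
  constS c (suc _) = 0#

  natS : ℕ → Series
  natS n = constS (fromℕ n)

  X : Series
  X zero          = 0#
  X (suc zero)    = 1#
  X (suc (suc _)) = 0#

  _+ₛ_ : Series → Series → Series
  (p +ₛ q) k = p k + q k

  sumTo : ℕ → (ℕ → Carrier) → Carrier
  sumTo zero    f = f 0
  sumTo (suc n) f = sumTo n f + f (suc n)

  _*ₛ_ : Series → Series → Series
  (p *ₛ q) n = sumTo n (λ i → p i * q (n ∸ i))

  infixl 6 _+ₛ_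
  infixl 7 _*ₛ_

  Matrix : Set
  Matrix = ℕ → ℕ → Series

  MatEq : Matrix → Matrix → Set
  MatEq A B = ∀ i j → A i j ≈ₛ B i j

  -- Banded lower-Hessenberg matrix with superdiagonal entries 1,
  -- diagonal entries D n (at (n,n)), first subdiagonal S1 n (at (n+1,n)),
  -- second subdiagonal S2 n (at (n+2,n)), all other entries 0.
  band : (ℕ → Series) → (ℕ → Series) → (ℕ → Series) → Matrix
  band D S1 S2 zero zero = D 0
  band D S1 S2 zero (suc zero) = natS 1
  band D S1 S2 zero (suc (suc _)) = natS 0
  band D S1 S2 (suc zero) zero = S1 0
  band D S1 S2 (suc (suc zero)) zero = S2 0
  band D S1 S2 (suc (suc (suc _))) zero = natS 0
  band D S1 S2 (suc i) (suc j) =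
    band (λ n → D (suc n)) (λ n → S1 (suc n)) (λ n → S2 (suc n)) i j

  laguerreP : Matrix
  laguerreP = band
    (λ n → natS (2 ℕ.* n ℕ.+ 1) +ₛ X)
    (λ n → natS ((suc n) ℕ.* (suc n)) +ₛ natS (2 ℕ.* suc n) *ₛ X)
    (λ n → natS ((suc (suc n)) ℕ.* (suc n)) *ₛ X)

  -- α with the convention α₁ = 0 (α₀ is never used)
  alphaExt : (ℕ → Series) → ℕ → Series
  alphaExt α (suc zero) = natS 0
  alphaExt α i          = α i

  -- P^{(2;1)}(α):
  -- P_{n,n} = α_{3n+1}+α_{3n+2}+α_{3n+3}
  -- P_{n,n-1} = α_{3n-1}α_{3n+1}+α_{3n}α_{3n+1}+α_{3n}α_{3n+2}   (written with n ↦ n+1)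
  -- P_{n,n-2} = α_{3n-3}α_{3n-1}α_{3n+1}                          (written with n ↦ n+2)
  stieltjesP21 : (ℕ → Series) → Matrix
  stieltjesP21 α = band
    (λ n → a (3 ℕ.* n ℕ.+ 1) +ₛ a (3 ℕ.* n ℕ.+ 2) +ₛ a (3 ℕ.* n ℕ.+ 3))
    (λ n → a (3 ℕ.* n ℕ.+ 2) *ₛ a (3 ℕ.* n ℕ.+ 4)
         +ₛ a (3 ℕ.* n ℕ.+ 3) *ₛ a (3 ℕ.* n ℕ.+ 4)
         +ₛ a (3 ℕ.* n ℕ.+ 3) *ₛ a (3 ℕ.* n ℕ.+ 5))
    (λ n → a (3 ℕ.* n ℕ.+ 3) *ₛ a (3 ℕ.* n ℕ.+ 5) *ₛ a (3 ℕ.* n ℕ.+ 7))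
    where
      a : ℕ → Series
      a = alphaExt α

{-# OPTIONS --safe #-}
module Submission where

-- Nonnegativity and the diagonal 2n+1+x force every α_i to have degree at most 1. Writing
-- α_{3n+1} = r_n + s_n x, α_{3n+2} = u_n + v_n x, α_{3n+3} = p_n + q_n x and comparing
-- coefficients on the three nonzero diagonals gives a polynomial system. Positivity
-- of its x²-equation and α₁ = 0 give s = 0 and q_n v_{n+1} = 0; the subsubdiagonal
-- gives p_n u_{n+1} = 0, and then by induction r_n = n, u_n + p_n = n+1 and
-- p_n v_{n+1} + q_n u_{n+1} = n+1. Since v + q = 1, q_n q_{n+1} = q_n, so q_m absorbs
-- all later q_k; this propagates to q_m u_{k+1} = (k+1) q_m and q_m p_{m+2} = q_m,
-- whence (m+3) q_m = q_m p_{m+2} u_{m+3} = 0. The remaining values follow, and the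
-- converse is a direct computation.

open import Defs
  using (OrderedField; module OrderedField; Series; IsPoly; NonnegCoeffs; _≈ₛ_;
         natS; X; MatEq; band; laguerreP; alphaExt; stieltjesP21)
import Defs
open import Data.Nat as ℕ using (ℕ; zero; suc; z≤n; s≤s)
import Data.Nat.Properties as ℕₚ
open import Data.Nat.Tactic.RingSolver using (solve-∀)
open import Data.Product using (_×_; _,_; proj₁; proj₂)
open import Data.Sum using (inj₁; inj₂)
open import Function.Base using (_∘_)
open import Function.Bundles using (_⇔_; mk⇔)
open import Relation.Nullary using (¬_)
open import Relation.Binary.PropositionalEquality
open import Relation.Binary.Structures using (IsTotalOrder)
open import Algebra.Bundles using (CommutativeRing)
open import Algebra.Structures using (IsCommutativeRing)
import Algebra.Properties.Ring as RingProperties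
import Algebra.Properties.CommutativeSemigroup as CommutativeSemigroupProperties
open import Level using (0ℓ)

2n+1≡n+[1+n] : ∀ n → 2 ℕ.* n ℕ.+ 1 ≡ n ℕ.+ suc n
2n+1≡n+[1+n] = solve-∀

2[1+n]≡[1+n]+[1+n] : ∀ n → 2 ℕ.* suc n ≡ suc n ℕ.+ suc n
2[1+n]≡[1+n]+[1+n] = solve-∀

3[1+n]+1≡3n+4 : ∀ n → 3 ℕ.* suc n ℕ.+ 1 ≡ 3 ℕ.* n ℕ.+ 4
3[1+n]+1≡3n+4 = solve-∀

3[1+n]+2≡3n+5 : ∀ n → 3 ℕ.* suc n ℕ.+ 2 ≡ 3 ℕ.* n ℕ.+ 5
3[1+n]+2≡3n+5 = solve-∀

3[2+n]+1≡3n+7 : ∀ n → 3 ℕ.* suc (suc n) ℕ.+ 1 ≡ 3 ℕ.* n ℕ.+ 7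
3[2+n]+1≡3n+7 = solve-∀

module _ (F : OrderedField) where
  open OrderedField F
  open IsCommutativeRing isCommutativeRing
    using (+-comm; +-assoc; +-identityˡ; +-identityʳ; -‿inverseʳ;
           *-comm; *-assoc; *-identityˡ; *-identityʳ; distribˡ; distribʳ; zeroˡ; zeroʳ)
  private
    commutativeRing : CommutativeRing 0ℓ 0ℓ
    commutativeRing = record { isCommutativeRing = isCommutativeRing }
  open RingProperties (CommutativeRing.ring commutativeRing)
    using (+-cancelˡ; +-identityˡ-unique; -1*x≈-x; -‿involutive)
  open CommutativeSemigroupProperties (CommutativeRing.*-commutativeSemigroup commutativeRing)
    using (x∙yz≈y∙xz)
  private module ≤ = IsTotalOrder isTotalOrder
  open ≡-Reasoning

  0≤1 : 0# ≤ 1#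
  0≤1 with ≤.total 0# 1#
  ... | inj₁ 0≤1 = 0≤1
  ... | inj₂ 1≤0 = subst (0# ≤_) -1*-1≡1 (*-nonneg 0≤-1 0≤-1)
    where
    0≤-1 : 0# ≤ - 1#
    0≤-1 = subst₂ _≤_ (-‿inverseʳ 1#) (+-identityˡ (- 1#)) (+-mono-≤ (- 1#) 1≤0)
    -1*-1≡1 : - 1# * - 1# ≡ 1#
    -1*-1≡1 = trans (-1*x≈-x (- 1#)) (-‿involutive 1#)

  x≤x+y : ∀ x {y} → 0# ≤ y → x ≤ x + y
  x≤x+y x {y} 0≤y = subst₂ _≤_ (+-identityˡ x) (+-comm y x) (+-mono-≤ x 0≤y)

  +-nonneg : ∀ {x y} → 0# ≤ x → 0# ≤ y → 0# ≤ x + y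
  +-nonneg 0≤x 0≤y = ≤.trans 0≤x (x≤x+y _ 0≤y)

  nonneg-x+y≡0⇒x≡0 : ∀ {x y} → 0# ≤ x → 0# ≤ y → x + y ≡ 0# → x ≡ 0#
  nonneg-x+y≡0⇒x≡0 {x} 0≤x 0≤y x+y≡0 = ≤.antisym (subst (x ≤_) x+y≡0 (x≤x+y x 0≤y)) 0≤x

  nonneg-x+y+z≡0 : ∀ {x y z} → 0# ≤ x → 0# ≤ y → 0# ≤ z → x + y + z ≡ 0# →
                   x ≡ 0# × y ≡ 0# × z ≡ 0#
  nonneg-x+y+z≡0 {x} {y} {z} 0≤x 0≤y 0≤z x+y+z≡0 =
    nonneg-x+y≡0⇒x≡0 0≤x 0≤y x+y≡0 ,
    nonneg-x+y≡0⇒x≡0 0≤y 0≤x (trans (+-comm y x) x+y≡0) ,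
    nonneg-x+y≡0⇒x≡0 0≤z (+-nonneg 0≤x 0≤y) (trans (+-comm z (x + y)) x+y+z≡0)
    where
    x+y≡0 : x + y ≡ 0#
    x+y≡0 = nonneg-x+y≡0⇒x≡0 (+-nonneg 0≤x 0≤y) 0≤z x+y+z≡0

  *-cancelˡ-≢0 : ∀ {c x y} → ¬ c ≡ 0# → c * x ≡ c * y → x ≡ y
  *-cancelˡ-≢0 {c} {x} {y} c≢0 cx≡cy with *-inverse c c≢0
  ... | c⁻¹ , cc⁻¹≡1 = trans (sym (c⁻¹c· x)) (trans (cong (c⁻¹ *_) cx≡cy) (c⁻¹c· y))
    where
    c⁻¹c· : ∀ z → c⁻¹ * (c * z) ≡ z
    c⁻¹c· z = begin
      c⁻¹ * (c * z) ≡⟨ *-assoc c⁻¹ c z ⟨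
      c⁻¹ * c * z   ≡⟨ cong (_* z) (trans (*-comm c⁻¹ c) cc⁻¹≡1) ⟩
      1# * z        ≡⟨ *-identityˡ z ⟩
      z             ∎

  x*y≢0⇒y≢0 : ∀ {x y} → ¬ x * y ≡ 0# → ¬ y ≡ 0#
  x*y≢0⇒y≢0 {x} xy≢0 y≡0 = xy≢0 (trans (cong (x *_) y≡0) (zeroʳ x))

  ℕ→F : ℕ → Carrier
  ℕ→F = Defs.fromℕ F

  ℕ→F-+ : ∀ m n → ℕ→F (m ℕ.+ n) ≡ ℕ→F m + ℕ→F n
  ℕ→F-+ zero    n = sym (+-identityˡ (ℕ→F n))
  ℕ→F-+ (suc m) n = trans (cong (1# +_) (ℕ→F-+ m n)) (sym (+-assoc 1# (ℕ→F m) (ℕ→F n)))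

  ℕ→F-* : ∀ m n → ℕ→F (m ℕ.* n) ≡ ℕ→F m * ℕ→F n
  ℕ→F-* zero    n = sym (zeroˡ (ℕ→F n))
  ℕ→F-* (suc m) n = begin
    ℕ→F (n ℕ.+ m ℕ.* n)        ≡⟨ ℕ→F-+ n (m ℕ.* n) ⟩
    ℕ→F n + ℕ→F (m ℕ.* n)      ≡⟨ cong₂ _+_ (sym (*-identityˡ (ℕ→F n))) (ℕ→F-* m n) ⟩
    1# * ℕ→F n + ℕ→F m * ℕ→F n ≡⟨ distribʳ (ℕ→F n) 1# (ℕ→F m) ⟨
    (1# + ℕ→F m) * ℕ→F n       ∎

  ℕ→F-nonneg : ∀ n → 0# ≤ ℕ→F n
  ℕ→F-nonneg zero    = ≤.refl
  ℕ→F-nonneg (suc n) = +-nonneg 0≤1 (ℕ→F-nonneg n)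

  ℕ→F-suc≢0 : ∀ n → ¬ ℕ→F (suc n) ≡ 0#
  ℕ→F-suc≢0 n 1+n≡0 = 0≢1 (sym (nonneg-x+y≡0⇒x≡0 0≤1 (ℕ→F-nonneg n) 1+n≡0))

  _+ₛ_ _*ₛ_ : Series F → Series F → Series F
  _+ₛ_ = Defs._+ₛ_ F
  _*ₛ_ = Defs._*ₛ_ F
  infixl 6 _+ₛ_
  infixl 7 _*ₛ_

  sumTo : ℕ → (ℕ → Carrier) → Carrier
  sumTo = Defs.sumTo F

  constS : Carrier → Series F
  constS = Defs.constS F

  sumTo-cong : ∀ n {f g : ℕ → Carrier} → (∀ i → f i ≡ g i) → sumTo n f ≡ sumTo n g
  sumTo-cong zero    f≗g = f≗g 0
  sumTo-cong (suc n) f≗g = cong₂ _+_ (sumTo-cong n f≗g) (f≗g (suc n))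

  sumTo-head : ∀ n (f : ℕ → Carrier) → (∀ i → f (suc i) ≡ 0#) → sumTo n f ≡ f 0
  sumTo-head zero    f f[1+i]≡0 = refl
  sumTo-head (suc n) f f[1+i]≡0 =
    trans (cong₂ _+_ (sumTo-head n f f[1+i]≡0) (f[1+i]≡0 n)) (+-identityʳ (f 0))

  sumTo-zero : ∀ n (f : ℕ → Carrier) → (∀ i → i ℕ.≤ n → f i ≡ 0#) → sumTo n f ≡ 0#
  sumTo-zero zero    f f≡0 = f≡0 0 z≤n
  sumTo-zero (suc n) f f≡0 =
    trans (cong₂ _+_ (sumTo-zero n f (λ i i≤n → f≡0 i (ℕₚ.m≤n⇒m≤1+n i≤n)))
                     (f≡0 (suc n) ℕₚ.≤-refl))
          (+-identityʳ 0#)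

  sumTo-last : ∀ n (f : ℕ → Carrier) → (∀ i → i ℕ.< n → f i ≡ 0#) → sumTo n f ≡ f n
  sumTo-last zero    f f≡0 = refl
  sumTo-last (suc n) f f≡0 =
    trans (cong (_+ f (suc n)) (sumTo-zero n f (λ i i≤n → f≡0 i (s≤s i≤n))))
          (+-identityˡ (f (suc n)))

  *ₛ-cong : ∀ {P P′ Q Q′} → P ≗ P′ → Q ≗ Q′ → P *ₛ Q ≗ P′ *ₛ Q′
  *ₛ-cong P≗P′ Q≗Q′ k = sumTo-cong k (λ i → cong₂ _*_ (P≗P′ i) (Q≗Q′ (k ℕ.∸ i)))

  constS-*ₛ : ∀ c Q k → (constS c *ₛ Q) k ≡ c * Q k
  constS-*ₛ c Q k = sumTo-head k _ (λ i → zeroˡ _)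

  *ₛ-constS : ∀ P c k → (P *ₛ constS c) k ≡ P k * c
  *ₛ-constS P c k =
    trans (sumTo-last k _ (λ i i<k → trans (cong (P i *_) (constS[k∸i]≡0 k i i<k)) (zeroʳ (P i))))
          (cong (λ j → P k * constS c j) (ℕₚ.n∸n≡0 k))
    where
    constS[k∸i]≡0 : ∀ k i → i ℕ.< k → constS c (k ℕ.∸ i) ≡ 0#
    constS[k∸i]≡0 (suc k) zero    i<k       = refl
    constS[k∸i]≡0 (suc k) (suc i) (s≤s i<k) = constS[k∸i]≡0 k i i<k

  *ₛ-coeff₂ : ∀ P Q → P 2 ≡ 0# → Q 2 ≡ 0# → (P *ₛ Q) 2 ≡ P 1 * Q 1
  *ₛ-coeff₂ P Q P₂≡0 Q₂≡0 = begin
    P 0 * Q 2 + P 1 * Q 1 + P 2 * Q 0 ≡⟨ cong₂ (λ y z → P 0 * y + P 1 * Q 1 + z * Q 0) Q₂≡0 P₂≡0 ⟩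
    P 0 * 0# + P 1 * Q 1 + 0# * Q 0   ≡⟨ cong₂ (λ y z → y + P 1 * Q 1 + z) (zeroʳ (P 0)) (zeroˡ (Q 0)) ⟩
    0# + P 1 * Q 1 + 0#               ≡⟨ trans (+-identityʳ _) (+-identityˡ _) ⟩
    P 1 * Q 1                         ∎

  affine : Carrier → Carrier → Series F
  affine a b zero          = a
  affine a b (suc zero)    = b
  affine a b (suc (suc k)) = 0#

  ≗affine : ∀ P {a b} → P 0 ≡ a → P 1 ≡ b → (∀ k → P (suc (suc k)) ≡ 0#) → P ≗ affine a b
  ≗affine P P₀≡a P₁≡b P₂₊≡0 zero          = P₀≡a
  ≗affine P P₀≡a P₁≡b P₂₊≡0 (suc zero)    = P₁≡b
  ≗affine P P₀≡a P₁≡b P₂₊≡0 (suc (suc k)) = P₂₊≡0 k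

  band-suc-suc : ∀ D S₁ S₂ i j →
    band F D S₁ S₂ (suc i) (suc j) ≡ band F (D ∘ suc) (S₁ ∘ suc) (S₂ ∘ suc) i j
  band-suc-suc D S₁ S₂ zero                j       = refl
  band-suc-suc D S₁ S₂ (suc zero)          zero    = refl
  band-suc-suc D S₁ S₂ (suc zero)          (suc j) = refl
  band-suc-suc D S₁ S₂ (suc (suc zero))    zero    = refl
  band-suc-suc D S₁ S₂ (suc (suc zero))    (suc j) = refl
  band-suc-suc D S₁ S₂ (suc (suc (suc i))) zero    = refl
  band-suc-suc D S₁ S₂ (suc (suc (suc i))) (suc j) = refl

  band-diag : ∀ D S₁ S₂ n → band F D S₁ S₂ n n ≡ D n
  band-diag D S₁ S₂ zero    = refl
  band-diag D S₁ S₂ (suc n) =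
    trans (band-suc-suc D S₁ S₂ n n) (band-diag (D ∘ suc) (S₁ ∘ suc) (S₂ ∘ suc) n)

  band-sub₁ : ∀ D S₁ S₂ n → band F D S₁ S₂ (suc n) n ≡ S₁ n
  band-sub₁ D S₁ S₂ zero    = refl
  band-sub₁ D S₁ S₂ (suc n) =
    trans (band-suc-suc D S₁ S₂ (suc n) n) (band-sub₁ (D ∘ suc) (S₁ ∘ suc) (S₂ ∘ suc) n)

  band-sub₂ : ∀ D S₁ S₂ n → band F D S₁ S₂ (suc (suc n)) n ≡ S₂ n
  band-sub₂ D S₁ S₂ zero    = refl
  band-sub₂ D S₁ S₂ (suc n) =
    trans (band-suc-suc D S₁ S₂ (suc (suc n)) n) (band-sub₂ (D ∘ suc) (S₁ ∘ suc) (S₂ ∘ suc) n)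

  band-cong : ∀ {D S₁ S₂ D′ S₁′ S₂′} →
    (∀ n → D n ≗ D′ n) → (∀ n → S₁ n ≗ S₁′ n) → (∀ n → S₂ n ≗ S₂′ n) →
    MatEq F (band F D S₁ S₂) (band F D′ S₁′ S₂′)
  band-cong D≗ S₁≗ S₂≗ zero                zero          = D≗ 0
  band-cong D≗ S₁≗ S₂≗ zero                (suc zero)    = λ _ → refl
  band-cong D≗ S₁≗ S₂≗ zero                (suc (suc j)) = λ _ → refl
  band-cong D≗ S₁≗ S₂≗ (suc zero)          zero          = S₁≗ 0
  band-cong D≗ S₁≗ S₂≗ (suc (suc zero))    zero          = S₂≗ 0
  band-cong D≗ S₁≗ S₂≗ (suc (suc (suc i))) zero          = λ _ → refl
  band-cong {D} {S₁} {S₂} {D′} {S₁′} {S₂′} D≗ S₁≗ S₂≗ (suc i) (suc j) =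
    subst₂ _≗_ (sym (band-suc-suc D S₁ S₂ i j)) (sym (band-suc-suc D′ S₁′ S₂′ i j))
      (band-cong (D≗ ∘ suc) (S₁≗ ∘ suc) (S₂≗ ∘ suc) i j)

  band-injective : ∀ {D S₁ S₂ D′ S₁′ S₂′} → MatEq F (band F D S₁ S₂) (band F D′ S₁′ S₂′) →
    (∀ n → D n ≗ D′ n) × (∀ n → S₁ n ≗ S₁′ n) × (∀ n → S₂ n ≗ S₂′ n)
  band-injective {D} {S₁} {S₂} {D′} {S₁′} {S₂′} eq =
    (λ n → subst₂ _≗_ (band-diag D S₁ S₂ n) (band-diag D′ S₁′ S₂′ n) (eq n n)) ,
    (λ n → subst₂ _≗_ (band-sub₁ D S₁ S₂ n) (band-sub₁ D′ S₁′ S₂′ n) (eq (suc n) n)) ,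
    (λ n → subst₂ _≗_ (band-sub₂ D S₁ S₂ n) (band-sub₂ D′ S₁′ S₂′ n) (eq (suc (suc n)) n))

  laguerreD laguerreS₁ laguerreS₂ : ℕ → Series F
  laguerreD  n = natS F (2 ℕ.* n ℕ.+ 1) +ₛ X F
  laguerreS₁ n = natS F (suc n ℕ.* suc n) +ₛ natS F (2 ℕ.* suc n) *ₛ X F
  laguerreS₂ n = natS F (suc (suc n) ℕ.* suc n) *ₛ X F

  laguerreD≗ : ∀ n → laguerreD n ≗ affine (ℕ→F (2 ℕ.* n ℕ.+ 1)) 1#
  laguerreD≗ n = ≗affine (laguerreD n) (+-identityʳ _) (+-identityˡ 1#) (λ _ → +-identityʳ 0#)

  laguerreS₁≗ : ∀ n → laguerreS₁ n ≗ affine (ℕ→F (suc n ℕ.* suc n)) (ℕ→F (2 ℕ.* suc n))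
  laguerreS₁≗ n = ≗affine (laguerreS₁ n)
    (trans (cong (ℕ→F (suc n ℕ.* suc n) +_) (zeroʳ _)) (+-identityʳ _))
    (trans (cong (0# +_) (constS-*ₛ _ (X F) 1)) (trans (+-identityˡ _) (*-identityʳ _)))
    (λ k → trans (cong (0# +_) (trans (constS-*ₛ _ (X F) (suc (suc k))) (zeroʳ _))) (+-identityʳ 0#))

  laguerreS₂≗ : ∀ n → laguerreS₂ n ≗ affine 0# (ℕ→F (suc (suc n) ℕ.* suc n))
  laguerreS₂≗ n = ≗affine (laguerreS₂ n) (zeroʳ _)
    (trans (constS-*ₛ _ (X F) 1) (*-identityʳ _))
    (λ k → trans (constS-*ₛ _ (X F) (suc (suc k))) (zeroʳ _))

  module Stieltjes (α : ℕ → Series F) where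
    a : ℕ → Series F
    a = alphaExt F α

    stieltjesD stieltjesS₁ stieltjesS₂ : ℕ → Series F
    stieltjesD  n = a (3 ℕ.* n ℕ.+ 1) +ₛ a (3 ℕ.* n ℕ.+ 2) +ₛ a (3 ℕ.* n ℕ.+ 3)
    stieltjesS₁ n = a (3 ℕ.* n ℕ.+ 2) *ₛ a (3 ℕ.* n ℕ.+ 4)
                 +ₛ a (3 ℕ.* n ℕ.+ 3) *ₛ a (3 ℕ.* n ℕ.+ 4)
                 +ₛ a (3 ℕ.* n ℕ.+ 3) *ₛ a (3 ℕ.* n ℕ.+ 5)
    stieltjesS₂ n = a (3 ℕ.* n ℕ.+ 3) *ₛ a (3 ℕ.* n ℕ.+ 5) *ₛ a (3 ℕ.* n ℕ.+ 7)

    a₁ a₂ a₃ : ℕ → Series F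
    a₁ n = a (3 ℕ.* n ℕ.+ 1)
    a₂ n = a (3 ℕ.* n ℕ.+ 2)
    a₃ n = a (3 ℕ.* n ℕ.+ 3)

    stieltjesS₁≡ : ∀ n →
      stieltjesS₁ n ≡ a₂ n *ₛ a₁ (suc n) +ₛ a₃ n *ₛ a₁ (suc n) +ₛ a₃ n *ₛ a₂ (suc n)
    stieltjesS₁≡ n = cong₂ (λ b c → a₂ n *ₛ b +ₛ a₃ n *ₛ b +ₛ a₃ n *ₛ c)
      (cong a (sym (3[1+n]+1≡3n+4 n))) (cong a (sym (3[1+n]+2≡3n+5 n)))

    stieltjesS₂≡ : ∀ n → stieltjesS₂ n ≡ a₃ n *ₛ a₂ (suc n) *ₛ a₁ (suc (suc n))
    stieltjesS₂≡ n = cong₂ (λ b c → a₃ n *ₛ b *ₛ c)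
      (cong a (sym (3[1+n]+2≡3n+5 n))) (cong a (sym (3[2+n]+1≡3n+7 n)))

    a≡α : ∀ i → 2 ℕ.≤ i → a i ≡ α i
    a≡α (suc zero)    (s≤s ())
    a≡α (suc (suc i)) _        = refl

    a₂≡α : ∀ m → a₂ m ≡ α (3 ℕ.* m ℕ.+ 2)
    a₂≡α m = a≡α _ (ℕₚ.m≤n+m 2 (3 ℕ.* m))

    a₃≡α : ∀ m → a₃ m ≡ α (3 ℕ.* m ℕ.+ 3)
    a₃≡α m = a≡α _ (ℕₚ.≤-trans (ℕₚ.n≤1+n 2) (ℕₚ.m≤n+m 3 (3 ℕ.* m)))

    a₁[1+m]≡α : ∀ m → a₁ (suc m) ≡ α (3 ℕ.* m ℕ.+ 4)
    a₁[1+m]≡α m = trans (cong a (3[1+n]+1≡3n+4 m))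
                        (a≡α _ (ℕₚ.≤-trans (ℕₚ.m≤m+n 2 2) (ℕₚ.m≤n+m 4 (3 ℕ.* m))))

  -- The x⁰, x¹, x² coefficients of the entries of P = P^{(2;1)}(α) (with r₀, s₀ from α₁ = 0),
  -- when α_{3n+1} = r n + s n x,  α_{3n+2} = u n + v n x,  α_{3n+3} = p n + q n x.
  record CoefficientSystem : Set where
    field
      r s u v p q : ℕ → Carrier
      s≥0 : ∀ n → 0# ≤ s n
      v≥0 : ∀ n → 0# ≤ v n
      q≥0 : ∀ n → 0# ≤ q n
      r₀ : r 0 ≡ 0#
      s₀ : s 0 ≡ 0#
      D[x⁰] : ∀ n → r n + u n + p n ≡ ℕ→F (2 ℕ.* n ℕ.+ 1)
      D[x¹] : ∀ n → s n + v n + q n ≡ 1#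
      S₁[x⁰] : ∀ n → u n * r (suc n) + p n * r (suc n) + p n * u (suc n) ≡ ℕ→F (suc n ℕ.* suc n)
      S₁[x¹] : ∀ n → (u n * s (suc n) + v n * r (suc n)) + (p n * s (suc n) + q n * r (suc n))
                     + (p n * v (suc n) + q n * u (suc n)) ≡ ℕ→F (2 ℕ.* suc n)
      S₁[x²] : ∀ n → v n * s (suc n) + q n * s (suc n) + q n * v (suc n) ≡ 0#
      S₂[x⁰] : ∀ n → p n * u (suc n) * r (suc (suc n)) ≡ 0#
      S₂[x¹] : ∀ n → p n * u (suc n) * s (suc (suc n))
                     + (p n * v (suc n) + q n * u (suc n)) * r (suc (suc n))
                     ≡ ℕ→F (suc (suc n) ℕ.* suc n)

  module CoefficientSolution (system : CoefficientSystem) where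
    open CoefficientSystem system

    S₁[x²]-terms≡0 : ∀ n → v n * s (suc n) ≡ 0# × q n * s (suc n) ≡ 0# × q n * v (suc n) ≡ 0#
    S₁[x²]-terms≡0 n = nonneg-x+y+z≡0 (*-nonneg (v≥0 n) (s≥0 (suc n))) (*-nonneg (q≥0 n) (s≥0 (suc n)))
                                      (*-nonneg (q≥0 n) (v≥0 (suc n))) (S₁[x²] n)

    s≡0 : ∀ n → s n ≡ 0#
    s≡0 zero    = s₀
    s≡0 (suc n) = begin
      s (suc n)                                       ≡⟨ *-identityˡ _ ⟨
      1# * s (suc n)                                  ≡⟨ cong (_* s (suc n)) (D[x¹] n) ⟨
      (s n + v n + q n) * s (suc n)                   ≡⟨ distribʳ _ _ _ ⟩
      (s n + v n) * s (suc n) + q n * s (suc n)       ≡⟨ cong (_+ q n * s (suc n)) (distribʳ _ _ _) ⟩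
      s n * s (suc n) + v n * s (suc n) + q n * s (suc n)
        ≡⟨ cong₂ _+_ (cong₂ _+_ (trans (cong (_* s (suc n)) (s≡0 n)) (zeroˡ _)) vs′≡0) qs′≡0 ⟩
      0# + 0# + 0#                                    ≡⟨ trans (+-identityʳ _) (+-identityˡ 0#) ⟩
      0#                                              ∎
      where
      vs′≡0 = proj₁ (S₁[x²]-terms≡0 n)
      qs′≡0 = proj₁ (proj₂ (S₁[x²]-terms≡0 n))

    v+q≡1 : ∀ n → v n + q n ≡ 1#
    v+q≡1 n = begin
      v n + q n       ≡⟨ cong (_+ q n) (+-identityˡ (v n)) ⟨
      0# + v n + q n  ≡⟨ cong (λ t → t + v n + q n) (s≡0 n) ⟨
      s n + v n + q n ≡⟨ D[x¹] n ⟩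
      1#              ∎

    p[n]u[1+n]≡0 : ∀ n → p n * u (suc n) ≡ 0#
    p[n]u[1+n]≡0 n = *-cancelˡ-≢0 r[2+n]≢0 (trans (*-comm _ _) (trans (S₂[x⁰] n) (sym (zeroʳ _))))
      where
      Yr≡ : (p n * v (suc n) + q n * u (suc n)) * r (suc (suc n)) ≡ ℕ→F (suc (suc n) ℕ.* suc n)
      Yr≡ = begin
        (p n * v (suc n) + q n * u (suc n)) * r (suc (suc n))
          ≡⟨ +-identityˡ _ ⟨
        0# + (p n * v (suc n) + q n * u (suc n)) * r (suc (suc n))
          ≡⟨ cong (_+ _) (trans (cong (p n * u (suc n) *_) (s≡0 (suc (suc n)))) (zeroʳ _)) ⟨
        p n * u (suc n) * s (suc (suc n)) + (p n * v (suc n) + q n * u (suc n)) * r (suc (suc n))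
          ≡⟨ S₂[x¹] n ⟩
        ℕ→F (suc (suc n) ℕ.* suc n) ∎
      r[2+n]≢0 : ¬ r (suc (suc n)) ≡ 0#
      r[2+n]≢0 = x*y≢0⇒y≢0 λ Yr≡0 →
        ℕ→F-suc≢0 (n ℕ.+ suc n ℕ.* suc n) (trans (sym Yr≡) Yr≡0)

    r≡n : ∀ n → r n ≡ ℕ→F n
    u+p≡1+n : ∀ n → u n + p n ≡ ℕ→F (suc n)

    u+p≡1+n n = +-cancelˡ (ℕ→F n) _ _ (begin
      ℕ→F n + (u n + p n) ≡⟨ +-assoc _ _ _ ⟨
      ℕ→F n + u n + p n   ≡⟨ cong (λ t → t + u n + p n) (r≡n n) ⟨
      r n + u n + p n     ≡⟨ D[x⁰] n ⟩
      ℕ→F (2 ℕ.* n ℕ.+ 1) ≡⟨ cong ℕ→F (2n+1≡n+[1+n] n) ⟩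
      ℕ→F (n ℕ.+ suc n)   ≡⟨ ℕ→F-+ n (suc n) ⟩
      ℕ→F n + ℕ→F (suc n) ∎)

    r≡n zero    = r₀
    r≡n (suc n) = *-cancelˡ-≢0 (ℕ→F-suc≢0 n) (begin
      ℕ→F (suc n) * r (suc n)                                     ≡⟨ cong (_* r (suc n)) (u+p≡1+n n) ⟨
      (u n + p n) * r (suc n)                                     ≡⟨ distribʳ _ _ _ ⟩
      u n * r (suc n) + p n * r (suc n)                           ≡⟨ +-identityʳ _ ⟨
      u n * r (suc n) + p n * r (suc n) + 0#                      ≡⟨ cong (_ +_) (p[n]u[1+n]≡0 n) ⟨
      u n * r (suc n) + p n * r (suc n) + p n * u (suc n)         ≡⟨ S₁[x⁰] n ⟩
      ℕ→F (suc n ℕ.* suc n)                                       ≡⟨ ℕ→F-* (suc n) (suc n) ⟩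
      ℕ→F (suc n) * ℕ→F (suc n)                                   ∎)

    pv′+qu′≡1+n : ∀ n → p n * v (suc n) + q n * u (suc n) ≡ ℕ→F (suc n)
    pv′+qu′≡1+n n = +-cancelˡ M _ _ (begin
      M + Y                                               ≡⟨ cong (_+ Y) vM+qM≡M ⟨
      v n * M + q n * M + Y                               ≡⟨ cong (_+ Y) (cong₂ _+_ (xs′+yr′≡yM (u n) (v n))
                                                                                   (xs′+yr′≡yM (p n) (q n))) ⟨
      (u n * s (suc n) + v n * r (suc n))
        + (p n * s (suc n) + q n * r (suc n)) + Y         ≡⟨ S₁[x¹] n ⟩
      ℕ→F (2 ℕ.* suc n)                                   ≡⟨ cong ℕ→F (2[1+n]≡[1+n]+[1+n] n) ⟩
      ℕ→F (suc n ℕ.+ suc n)                               ≡⟨ ℕ→F-+ (suc n) (suc n) ⟩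
      M + M                                               ∎)
      where
      M Y : Carrier
      M = ℕ→F (suc n)
      Y = p n * v (suc n) + q n * u (suc n)
      xs′+yr′≡yM : ∀ x y → x * s (suc n) + y * r (suc n) ≡ y * M
      xs′+yr′≡yM x y =
        trans (cong₂ _+_ (trans (cong (x *_) (s≡0 (suc n))) (zeroʳ x)) (cong (y *_) (r≡n (suc n))))
              (+-identityˡ _)
      vM+qM≡M : v n * M + q n * M ≡ M
      vM+qM≡M = trans (sym (distribʳ M (v n) (q n))) (trans (cong (_* M) (v+q≡1 n)) (*-identityˡ M))

    qq′≡q : ∀ n → q n * q (suc n) ≡ q n
    qq′≡q n = begin
      q n * q (suc n)                   ≡⟨ +-identityˡ _ ⟨
      0# + q n * q (suc n)              ≡⟨ cong (_+ _) (proj₂ (proj₂ (S₁[x²]-terms≡0 n))) ⟨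
      q n * v (suc n) + q n * q (suc n) ≡⟨ distribˡ _ _ _ ⟨
      q n * (v (suc n) + q (suc n))     ≡⟨ cong (q n *_) (v+q≡1 (suc n)) ⟩
      q n * 1#                          ≡⟨ *-identityʳ _ ⟩
      q n                               ∎

    -- q m ≟ 0# is undecidable, so instead of splitting on it we multiply through by Q = q m.
    q≡0 : ∀ m → q m ≡ 0#
    q≡0 m = *-cancelˡ-≢0 (ℕ→F-suc≢0 (suc (suc m))) (begin
      ℕ→F (3 ℕ.+ m) * Q                       ≡⟨ *-comm _ Q ⟩
      Q * ℕ→F (3 ℕ.+ m)                       ≡⟨ Qu[1+k]≡Q[1+k] (2 ℕ.+ m) absorbs₂ absorbs₃ ⟨
      Q * u (3 ℕ.+ m)                         ≡⟨ cong (_* u (3 ℕ.+ m)) Qp[2+m]≡Q ⟨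
      Q * p (2 ℕ.+ m) * u (3 ℕ.+ m)           ≡⟨ *-assoc Q _ _ ⟩
      Q * (p (2 ℕ.+ m) * u (3 ℕ.+ m))         ≡⟨ cong (Q *_) (p[n]u[1+n]≡0 (2 ℕ.+ m)) ⟩
      Q * 0#                                  ≡⟨ zeroʳ Q ⟩
      0#                                      ≡⟨ zeroʳ _ ⟨
      ℕ→F (3 ℕ.+ m) * 0#                      ∎)
      where
      Q : Carrier
      Q = q m

      Absorbs : ℕ → Set
      Absorbs k = Q * q k ≡ Q

      absorbs-suc : ∀ k → Absorbs k → Absorbs (suc k)
      absorbs-suc k Qq≡Q = begin
        Q * q (suc k)         ≡⟨ cong (_* q (suc k)) Qq≡Q ⟨
        Q * q k * q (suc k)   ≡⟨ *-assoc Q _ _ ⟩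
        Q * (q k * q (suc k)) ≡⟨ cong (Q *_) (qq′≡q k) ⟩
        Q * q k               ≡⟨ Qq≡Q ⟩
        Q                     ∎

      absorbs₁ : Absorbs (1 ℕ.+ m)
      absorbs₁ = qq′≡q m
      absorbs₂ : Absorbs (2 ℕ.+ m)
      absorbs₂ = absorbs-suc _ absorbs₁
      absorbs₃ : Absorbs (3 ℕ.+ m)
      absorbs₃ = absorbs-suc _ absorbs₂

      Qu[1+k]≡Q[1+k] : ∀ k → Absorbs k → Absorbs (suc k) → Q * u (suc k) ≡ Q * ℕ→F (suc k)
      Qu[1+k]≡Q[1+k] k Qq≡Q Qq′≡Q = begin
        Q * u (suc k)                                 ≡⟨ +-identityˡ _ ⟨
        0# + Q * u (suc k)                            ≡⟨ cong₂ _+_ pQv′≡0 (cong (_* u (suc k)) Qq≡Q) ⟨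
        p k * (Q * v (suc k)) + Q * q k * u (suc k)   ≡⟨ cong₂ _+_ (x∙yz≈y∙xz (p k) Q (v (suc k)))
                                                                   (*-assoc Q (q k) (u (suc k))) ⟩
        Q * (p k * v (suc k)) + Q * (q k * u (suc k)) ≡⟨ distribˡ Q _ _ ⟨
        Q * (p k * v (suc k) + q k * u (suc k))       ≡⟨ cong (Q *_) (pv′+qu′≡1+n k) ⟩
        Q * ℕ→F (suc k)                               ∎
        where
        Qv′≡0 : Q * v (suc k) ≡ 0#
        Qv′≡0 = +-identityˡ-unique _ Q (begin
          Q * v (suc k) + Q             ≡⟨ cong (Q * v (suc k) +_) Qq′≡Q ⟨
          Q * v (suc k) + Q * q (suc k) ≡⟨ distribˡ Q _ _ ⟨
          Q * (v (suc k) + q (suc k))   ≡⟨ cong (Q *_) (v+q≡1 (suc k)) ⟩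
          Q * 1#                        ≡⟨ *-identityʳ Q ⟩
          Q                             ∎)
        pQv′≡0 : p k * (Q * v (suc k)) ≡ 0#
        pQv′≡0 = trans (cong (p k *_) Qv′≡0) (zeroʳ (p k))

      Qp[2+m]≡Q : Q * p (2 ℕ.+ m) ≡ Q
      Qp[2+m]≡Q = +-cancelˡ (Q * N) _ _ (begin
        Q * N + Q * p (2 ℕ.+ m)           ≡⟨ cong (_+ Q * p (2 ℕ.+ m)) Qu[2+m]≡QN ⟨
        Q * u (2 ℕ.+ m) + Q * p (2 ℕ.+ m) ≡⟨ distribˡ Q _ _ ⟨
        Q * (u (2 ℕ.+ m) + p (2 ℕ.+ m))   ≡⟨ cong (Q *_) (u+p≡1+n (2 ℕ.+ m)) ⟩
        Q * (1# + N)                      ≡⟨ distribˡ Q 1# N ⟩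
        Q * 1# + Q * N                    ≡⟨ cong (_+ Q * N) (*-identityʳ Q) ⟩
        Q + Q * N                         ≡⟨ +-comm Q (Q * N) ⟩
        Q * N + Q                         ∎)
        where
        N : Carrier
        N = ℕ→F (2 ℕ.+ m)
        Qu[2+m]≡QN : Q * u (2 ℕ.+ m) ≡ Q * N
        Qu[2+m]≡QN = Qu[1+k]≡Q[1+k] (1 ℕ.+ m) absorbs₁ absorbs₂

    v≡1 : ∀ n → v n ≡ 1#
    v≡1 n = trans (sym (+-identityʳ (v n))) (trans (cong (v n +_) (sym (q≡0 n))) (v+q≡1 n))

    p≡1+n : ∀ n → p n ≡ ℕ→F (suc n)
    p≡1+n n = begin
      p n                               ≡⟨ trans (+-identityʳ _) (*-identityʳ (p n)) ⟨
      p n * 1# + 0#                     ≡⟨ cong₂ (λ t w → p n * t + w) (v≡1 (suc n))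
                                                 (trans (cong (_* u (suc n)) (q≡0 n)) (zeroˡ _)) ⟨
      p n * v (suc n) + q n * u (suc n) ≡⟨ pv′+qu′≡1+n n ⟩
      ℕ→F (suc n)                       ∎

    u≡0 : ∀ n → u n ≡ 0#
    u≡0 n = +-identityˡ-unique (u n) (p n) (trans (u+p≡1+n n) (sym (p≡1+n n)))

  IsLaguerreSequence : (ℕ → Series F) → Set
  IsLaguerreSequence α = ∀ m → α (3 ℕ.* m ℕ.+ 2) ≗ X F
                             × α (3 ℕ.* m ℕ.+ 3) ≗ natS F (suc m)
                             × α (3 ℕ.* m ℕ.+ 4) ≗ natS F (suc m)

  X≗affine : X F ≗ affine 0# 1#
  X≗affine = ≗affine (X F) refl refl (λ _ → refl)

  natS≗affine : ∀ n → natS F n ≗ affine (ℕ→F n) 0#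
  natS≗affine n = ≗affine (natS F n) refl refl (λ _ → refl)

  module Forward (α : ℕ → Series F) (α-nonneg : ∀ i → 2 ℕ.≤ i → NonnegCoeffs F (α i))
                 (P≡P21 : MatEq F (laguerreP F) (stieltjesP21 F α)) where
    open Stieltjes α

    D≗ : ∀ n → laguerreD n ≗ stieltjesD n
    D≗ = proj₁ (band-injective P≡P21)

    S₁≗ : ∀ n → laguerreS₁ n ≗ a₂ n *ₛ a₁ (suc n) +ₛ a₃ n *ₛ a₁ (suc n) +ₛ a₃ n *ₛ a₂ (suc n)
    S₁≗ n k = trans (proj₁ (proj₂ (band-injective P≡P21)) n k) (cong-app (stieltjesS₁≡ n) k)

    S₂≗ : ∀ n → laguerreS₂ n ≗ a₃ n *ₛ a₂ (suc n) *ₛ a₁ (suc (suc n))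
    S₂≗ n k = trans (proj₂ (proj₂ (band-injective P≡P21)) n k) (cong-app (stieltjesS₂≡ n) k)

    a-nonneg : ∀ i → 1 ℕ.≤ i → NonnegCoeffs F (a i)
    a-nonneg (suc zero)    _ zero    = ≤.refl
    a-nonneg (suc zero)    _ (suc k) = ≤.refl
    a-nonneg (suc (suc i)) _ k       = α-nonneg (suc (suc i)) (s≤s (s≤s z≤n)) k

    a₁-nonneg : ∀ n → NonnegCoeffs F (a₁ n)
    a₂-nonneg : ∀ n → NonnegCoeffs F (a₂ n)
    a₃-nonneg : ∀ n → NonnegCoeffs F (a₃ n)
    a₁-nonneg n = a-nonneg _ (ℕₚ.m≤n+m 1 (3 ℕ.* n))
    a₂-nonneg n = a-nonneg _ (ℕₚ.≤-trans (ℕₚ.n≤1+n 1) (ℕₚ.m≤n+m 2 (3 ℕ.* n)))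
    a₃-nonneg n = a-nonneg _ (ℕₚ.≤-trans (ℕₚ.m≤m+n 1 2) (ℕₚ.m≤n+m 3 (3 ℕ.* n)))

    a[2+k]≡0 : ∀ n k → a₁ n (2 ℕ.+ k) ≡ 0# × a₂ n (2 ℕ.+ k) ≡ 0# × a₃ n (2 ℕ.+ k) ≡ 0#
    a[2+k]≡0 n k = nonneg-x+y+z≡0 (a₁-nonneg n _) (a₂-nonneg n _) (a₃-nonneg n _)
                                  (trans (sym (D≗ n (2 ℕ.+ k))) (laguerreD≗ n (2 ℕ.+ k)))

    coefficientSystem : CoefficientSystem
    coefficientSystem = record
      { r = λ n → a₁ n 0 ; s = λ n → a₁ n 1
      ; u = λ n → a₂ n 0 ; v = λ n → a₂ n 1
      ; p = λ n → a₃ n 0 ; q = λ n → a₃ n 1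
      ; s≥0 = λ n → a₁-nonneg n 1
      ; v≥0 = λ n → a₂-nonneg n 1
      ; q≥0 = λ n → a₃-nonneg n 1
      ; r₀ = refl
      ; s₀ = refl
      ; D[x⁰] = λ n → trans (sym (D≗ n 0)) (laguerreD≗ n 0)
      ; D[x¹] = λ n → trans (sym (D≗ n 1)) (laguerreD≗ n 1)
      ; S₁[x⁰] = λ n → trans (sym (S₁≗ n 0)) (laguerreS₁≗ n 0)
      ; S₁[x¹] = λ n → trans (sym (S₁≗ n 1)) (laguerreS₁≗ n 1)
      ; S₁[x²] = λ n → trans (sym (S₁[x²]≡ n)) (trans (sym (S₁≗ n 2)) (laguerreS₁≗ n 2))
      ; S₂[x⁰] = λ n → trans (sym (S₂≗ n 0)) (laguerreS₂≗ n 0)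
      ; S₂[x¹] = λ n → trans (sym (S₂≗ n 1)) (laguerreS₂≗ n 1)
      }
      where
      a₁[2]≡0 : ∀ n → a₁ n 2 ≡ 0#
      a₁[2]≡0 n = proj₁ (a[2+k]≡0 n 0)
      a₂[2]≡0 : ∀ n → a₂ n 2 ≡ 0#
      a₂[2]≡0 n = proj₁ (proj₂ (a[2+k]≡0 n 0))
      a₃[2]≡0 : ∀ n → a₃ n 2 ≡ 0#
      a₃[2]≡0 n = proj₂ (proj₂ (a[2+k]≡0 n 0))
      S₁[x²]≡ : ∀ n → (a₂ n *ₛ a₁ (suc n) +ₛ a₃ n *ₛ a₁ (suc n) +ₛ a₃ n *ₛ a₂ (suc n)) 2
                     ≡ a₂ n 1 * a₁ (suc n) 1 + a₃ n 1 * a₁ (suc n) 1 + a₃ n 1 * a₂ (suc n) 1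
      S₁[x²]≡ n = cong₂ _+_ (cong₂ _+_ (*ₛ-coeff₂ (a₂ n) (a₁ (suc n)) (a₂[2]≡0 n) (a₁[2]≡0 (suc n)))
                                       (*ₛ-coeff₂ (a₃ n) (a₁ (suc n)) (a₃[2]≡0 n) (a₁[2]≡0 (suc n))))
                            (*ₛ-coeff₂ (a₃ n) (a₂ (suc n)) (a₃[2]≡0 n) (a₂[2]≡0 (suc n)))

    open CoefficientSolution coefficientSystem

    isLaguerreSequence : IsLaguerreSequence α
    isLaguerreSequence m =
      (λ k → trans (cong-app (sym (a₂≡α m)) k) (trans (a₂≗ k) (sym (X≗affine k)))) ,
      (λ k → trans (cong-app (sym (a₃≡α m)) k) (trans (a₃≗ k) (sym (natS≗affine (suc m) k)))) ,
      (λ k → trans (cong-app (sym (a₁[1+m]≡α m)) k) (trans (a₁≗ k) (sym (natS≗affine (suc m) k))))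
      where
      a₂≗ : a₂ m ≗ affine 0# 1#
      a₂≗ = ≗affine (a₂ m) (u≡0 m) (v≡1 m) (proj₁ ∘ proj₂ ∘ a[2+k]≡0 m)
      a₃≗ : a₃ m ≗ affine (ℕ→F (suc m)) 0#
      a₃≗ = ≗affine (a₃ m) (p≡1+n m) (q≡0 m) (proj₂ ∘ proj₂ ∘ a[2+k]≡0 m)
      a₁≗ : a₁ (suc m) ≗ affine (ℕ→F (suc m)) 0#
      a₁≗ = ≗affine (a₁ (suc m)) (r≡n (suc m)) (s≡0 (suc m)) (proj₁ ∘ a[2+k]≡0 (suc m))

  module Backward (α : ℕ → Series F) (α-values : IsLaguerreSequence α) where
    open Stieltjes α

    a₁≗ : ∀ n → a₁ n ≗ natS F n
    a₁≗ zero    k = refl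
    a₁≗ (suc n) k = trans (cong-app (a₁[1+m]≡α n) k) (proj₂ (proj₂ (α-values n)) k)

    a₂≗ : ∀ n → a₂ n ≗ X F
    a₂≗ n k = trans (cong-app (a₂≡α n) k) (proj₁ (α-values n) k)

    a₃≗ : ∀ n → a₃ n ≗ natS F (suc n)
    a₃≗ n k = trans (cong-app (a₃≡α n) k) (proj₁ (proj₂ (α-values n)) k)

    stieltjesD≗ : ∀ n → stieltjesD n ≗ affine (ℕ→F (2 ℕ.* n ℕ.+ 1)) 1#
    stieltjesD≗ n k = trans (coefficients k) (≗affine (λ k → natS F n k + X F k + natS F (suc n) k)
      (begin
        ℕ→F n + 0# + ℕ→F (suc n) ≡⟨ cong (_+ ℕ→F (suc n)) (+-identityʳ (ℕ→F n)) ⟩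
        ℕ→F n + ℕ→F (suc n)      ≡⟨ ℕ→F-+ n (suc n) ⟨
        ℕ→F (n ℕ.+ suc n)        ≡⟨ cong ℕ→F (2n+1≡n+[1+n] n) ⟨
        ℕ→F (2 ℕ.* n ℕ.+ 1)      ∎)
      (trans (+-identityʳ _) (+-identityˡ 1#))
      (λ _ → trans (+-identityʳ _) (+-identityʳ 0#)) k)
      where
      coefficients : ∀ k → stieltjesD n k ≡ natS F n k + X F k + natS F (suc n) k
      coefficients k = cong₂ _+_ (cong₂ _+_ (a₁≗ n k) (a₂≗ n k)) (a₃≗ n k)

    stieltjesS₁≗ : ∀ n → stieltjesS₁ n ≗ affine (ℕ→F (suc n ℕ.* suc n)) (ℕ→F (2 ℕ.* suc n))
    stieltjesS₁≗ n k = trans (coefficients k) (≗affine (λ k → X F k * M + M * natS F (suc n) k + M * X F k)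
      (begin
        0# * M + M * M + M * 0# ≡⟨ cong₂ (λ x y → x + M * M + y) (zeroˡ M) (zeroʳ M) ⟩
        0# + M * M + 0#         ≡⟨ trans (+-identityʳ _) (+-identityˡ _) ⟩
        M * M                   ≡⟨ ℕ→F-* (suc n) (suc n) ⟨
        ℕ→F (suc n ℕ.* suc n)   ∎)
      (begin
        1# * M + M * 0# + M * 1# ≡⟨ cong₂ (λ x y → x + M * 0# + y) (*-identityˡ M) (*-identityʳ M) ⟩
        M + M * 0# + M           ≡⟨ cong (λ x → M + x + M) (zeroʳ M) ⟩
        M + 0# + M               ≡⟨ cong (_+ M) (+-identityʳ M) ⟩
        M + M                    ≡⟨ ℕ→F-+ (suc n) (suc n) ⟨
        ℕ→F (suc n ℕ.+ suc n)    ≡⟨ cong ℕ→F (2[1+n]≡[1+n]+[1+n] n) ⟨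
        ℕ→F (2 ℕ.* suc n)        ∎)
      (λ _ → begin
        0# * M + M * 0# + M * 0# ≡⟨ cong₂ _+_ (cong₂ _+_ (zeroˡ M) (zeroʳ M)) (zeroʳ M) ⟩
        0# + 0# + 0#             ≡⟨ trans (+-identityʳ _) (+-identityʳ 0#) ⟩
        0#                       ∎)
      k)
      where
      M : Carrier
      M = ℕ→F (suc n)
      coefficients : ∀ k → stieltjesS₁ n k ≡ X F k * M + M * natS F (suc n) k + M * X F k
      coefficients k = trans (cong-app (stieltjesS₁≡ n) k) (cong₂ _+_ (cong₂ _+_
        (trans (*ₛ-cong (a₂≗ n) (a₁≗ (suc n)) k) (*ₛ-constS (X F) M k))
        (trans (*ₛ-cong (a₃≗ n) (a₁≗ (suc n)) k) (constS-*ₛ M (natS F (suc n)) k)))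
        (trans (*ₛ-cong (a₃≗ n) (a₂≗ (suc n)) k) (constS-*ₛ M (X F) k)))

    stieltjesS₂≗ : ∀ n → stieltjesS₂ n ≗ affine 0# (ℕ→F (suc (suc n) ℕ.* suc n))
    stieltjesS₂≗ n k = trans (coefficients k) (≗affine (λ k → M * X F k * M′)
      M*0*M′≡0
      (begin
        M * 1# * M′               ≡⟨ cong (_* M′) (*-identityʳ M) ⟩
        M * M′                    ≡⟨ *-comm M M′ ⟩
        M′ * M                    ≡⟨ ℕ→F-* (suc (suc n)) (suc n) ⟨
        ℕ→F (suc (suc n) ℕ.* suc n) ∎)
      (λ _ → M*0*M′≡0)
      k)
      where
      M M′ : Carrier
      M  = ℕ→F (suc n)
      M′ = ℕ→F (suc (suc n))
      M*0*M′≡0 : M * 0# * M′ ≡ 0#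
      M*0*M′≡0 = trans (cong (_* M′) (zeroʳ M)) (zeroˡ M′)
      coefficients : ∀ k → stieltjesS₂ n k ≡ M * X F k * M′
      coefficients k = trans (cong-app (stieltjesS₂≡ n) k)
        (trans (*ₛ-cong (*ₛ-cong (a₃≗ n) (a₂≗ (suc n))) (a₁≗ (suc (suc n))) k)
        (trans (*ₛ-constS (natS F (suc n) *ₛ X F) M′ k) (cong (_* M′) (constS-*ₛ M (X F) k))))

    P≡P21 : MatEq F (laguerreP F) (stieltjesP21 F α)
    P≡P21 = band-cong
      (λ n k → trans (laguerreD≗ n k) (sym (stieltjesD≗ n k)))
      (λ n k → trans (laguerreS₁≗ n k) (sym (stieltjesS₁≗ n k)))
      (λ n k → trans (laguerreS₂≗ n k) (sym (stieltjesS₂≗ n k)))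

open import Data.Nat using (_+_; _*_; _≤_)

propositionA12 : (F : OrderedField) → (α : ℕ → Series F) →
    (∀ i → 2 ≤ i → IsPoly F (α i) × NonnegCoeffs F (α i)) →
    (MatEq F (laguerreP F) (stieltjesP21 F α) ⇔
      (∀ m → (_≈ₛ_ F (α (3 * m + 2)) (X F))
           × (_≈ₛ_ F (α (3 * m + 3)) (natS F (suc m)))
           × (_≈ₛ_ F (α (3 * m + 4)) (natS F (suc m)))))
propositionA12 F α hyp = mk⇔
  (Forward.isLaguerreSequence F α (λ i 2≤i → proj₂ (hyp i 2≤i)))
  (Backward.P≡P21 F α)
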